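{- Let $G$ be a connected graph of order $n\ge 2$ and let $H$ be a non-trivial graph. If there exists an adjacency basis $S$ for $H$ which is also a dominating set of $H$, and such that for every $v\in V(H)\setminus S$ we have $S\not\subseteq N_H(v)$, then $$\operatorname{dim}_A(G\odot H)=n\cdot \operatorname{dim}_A(H).$$
   Context: All graphs are finite, simple, undirected; non-trivial means order at least 2. A set $S\subseteq V(H)$ is an adjacency generator for $H$ if for every two distinct $x,y\in V(H)\setminus S$ there exists $s\in S$ with $|N_H(s)\cap\{x,y\}|=1$ ($N_H$ the open neighbourhood); an adjacency basis is an adjacency generator of minimum cardinality, and this cardinality is $\operatorname{dim}_A(H)$. A dominating set $D$ satisfies $\bigcup_{v\in D}N_H[v]=V(H)$. The corona product $G\odot H$ ($G$ of order $n$ with vertices $v_1,\dots,v_n$) consists of $G$ and $n$ disjoint copies $H_1,\dots,H_n$ of $H$, with $v_i$ joined to every vertex of $H_i$. -}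

module Defs where

open import Data.Nat using (ℕ; zero; suc; _+_; _*_; _≤_)
open import Data.Fin using (Fin; _≟_; splitAt; remQuot)
open import Data.Fin.Subset using (Subset; _∈_; _∉_; ∣_∣)
open import Data.Bool using (Bool; true; false; _∧_)
open import Data.Bool.Properties using (∧-comm)
open import Data.Sum using (_⊎_; inj₁; inj₂)
open import Data.Product using (_×_; _,_; ∃; ∃-syntax)
open import Relation.Nullary using (¬_; yes; no)
open import Relation.Nullary.Decidable using (⌊_⌋)
open import Relation.Binary.PropositionalEquality using (_≡_; _≢_; refl; sym; cong₂)

record Graph (n : ℕ) : Set where
  field
    adj    : Fin n → Fin n → Bool
    adj-sym : ∀ u v → adj u v ≡ adj v u
    loopless : ∀ v → adj v v ≡ false

open Graph public

Adj : ∀ {n} → Graph n → Fin n → Fin n → Set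
Adj G u v = adj G u v ≡ true

data Walk {n} (G : Graph n) : Fin n → Fin n → Set where
  [] : ∀ {u} → Walk G u u
  _∷_ : ∀ {u v w} → Adj G u v → Walk G v w → Walk G u w

Connected : ∀ {n} → Graph n → Set
Connected {n} G = ∀ (u v : Fin n) → Walk G u v

Distinguishes : ∀ {n} → Graph n → Fin n → Fin n → Fin n → Set
Distinguishes G s x y = (Adj G s x × ¬ Adj G s y) ⊎ (¬ Adj G s x × Adj G s y)

IsAdjacencyGenerator : ∀ {n} → Graph n → Subset n → Set
IsAdjacencyGenerator {n} G S =
  ∀ (x y : Fin n) → x ≢ y → x ∉ S → y ∉ S →
    ∃[ s ] (s ∈ S × Distinguishes G s x y)

IsAdjacencyBasis : ∀ {n} → Graph n → Subset n → Set
IsAdjacencyBasis {n} G S =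
  IsAdjacencyGenerator G S × (∀ (T : Subset n) → IsAdjacencyGenerator G T → ∣ S ∣ ≤ ∣ T ∣)

DimA : ∀ {n} → Graph n → ℕ → Set
DimA {n} G d =
  (∃[ S ] (IsAdjacencyGenerator G S × ∣ S ∣ ≡ d)) ×
  (∀ (T : Subset n) → IsAdjacencyGenerator G T → d ≤ ∣ T ∣)

IsDominating : ∀ {n} → Graph n → Subset n → Set
IsDominating {n} G D = ∀ (v : Fin n) → v ∈ D ⊎ (∃[ u ] (u ∈ D × Adj G u v))

SubsetOfNbhd : ∀ {n} → Graph n → Subset n → Fin n → Set
SubsetOfNbhd {n} G S v = ∀ (s : Fin n) → s ∈ S → Adj G v s

-- Vertex set Fin (n + n * m): the first n vertices are those of G
-- (v_i = i), the vertex (i , a) of Fin n × Fin m (via remQuot) is the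
-- copy of vertex a of H in the copy H_i.

CVertex : ℕ → ℕ → Set
CVertex n m = Fin n ⊎ (Fin n × Fin m)

decode : ∀ n m → Fin (n + n * m) → CVertex n m
decode n m x with splitAt n x
... | inj₁ i = inj₁ i
... | inj₂ p = inj₂ (remQuot m p)

eqF : ∀ {n} → Fin n → Fin n → Bool
eqF i j = ⌊ i ≟ j ⌋

eqF-sym : ∀ {n} (i j : Fin n) → eqF i j ≡ eqF j i
eqF-sym i j with i ≟ j | j ≟ i
... | yes _ | yes _ = refl
... | no _ | no _ = refl
... | yes p | no q = Data.Empty.⊥-elim (q (sym p))
  where import Data.Empty
... | no p | yes q = Data.Empty.⊥-elim (p (sym q))
  where import Data.Empty

eqF-refl : ∀ {n} (i : Fin n) → eqF i i ≡ true
eqF-refl i with i ≟ i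
... | yes _ = refl
... | no p = Data.Empty.⊥-elim (p refl)
  where import Data.Empty

cadj : ∀ {n m} → Graph n → Graph m → CVertex n m → CVertex n m → Bool
cadj G H (inj₁ i) (inj₁ j) = adj G i j
cadj G H (inj₁ i) (inj₂ (j , b)) = eqF i j
cadj G H (inj₂ (i , a)) (inj₁ j) = eqF i j
cadj G H (inj₂ (i , a)) (inj₂ (j , b)) = eqF i j ∧ adj H a b

cadj-sym : ∀ {n m} (G : Graph n) (H : Graph m) (x y : CVertex n m) →
           cadj G H x y ≡ cadj G H y x
cadj-sym G H (inj₁ i) (inj₁ j) = adj-sym G i j
cadj-sym G H (inj₁ i) (inj₂ (j , b)) = eqF-sym i j
cadj-sym G H (inj₂ (i , a)) (inj₁ j) = eqF-sym i j
cadj-sym G H (inj₂ (i , a)) (inj₂ (j , b)) = cong₂ _∧_ (eqF-sym i j) (adj-sym H a b)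

cadj-loop : ∀ {n m} (G : Graph n) (H : Graph m) (x : CVertex n m) →
            cadj G H x x ≡ false
cadj-loop G H (inj₁ i) = loopless G i
cadj-loop G H (inj₂ (i , a)) rewrite eqF-refl i = loopless H a

corona : ∀ {n m} → Graph n → Graph m → Graph (n + n * m)
corona {n} {m} G H = record
  { adj = λ x y → cadj G H (decode n m x) (decode n m y)
  ; adj-sym = λ x y → cadj-sym G H (decode n m x) (decode n m y)
  ; loopless = λ x → cadj-loop G H (decode n m x)
  }

_⊙_ : ∀ {n m} → Graph n → Graph m → Graph (n + n * m)
G ⊙ H = corona G H

module Submission where

-- The union of the n copies of S is an adjacency generator of
-- G ⊙ H (lemma copies-generator): two hubs v_i, v_j are told apart by any
-- vertex of S_i; a hub v_i and a vertex (i , b) by a vertex of S_i outside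
-- N(b); a hub v_i and (j , b) with j ≠ i by a vertex of S_j dominating b;
-- two vertices of one copy by the corresponding vertex of the basis S; and
-- vertices of different copies H_i, H_j by a vertex of S_i dominating the
-- first.
--
-- Only vertices of H_i distinguish two vertices of H_i
-- (separator-in-copy), so every adjacency generator W of G ⊙ H meets each
-- copy H_i in an adjacency generator of H (block-generator); the n blocks
-- are disjoint pieces of W, whence |W| ≥ n · dim_A H (blocks-bound).

open import Defs
open import Data.Nat using (ℕ; suc; _+_; _*_; _≤_; z≤n; s≤s)
open import Data.Nat.Properties using (≤-trans; ≤-antisym; +-mono-≤; m≤n+m)
open import Data.Fin using (Fin; zero; suc; _↑ˡ_; _↑ʳ_; combine; splitAt)
  renaming (_≟_ to _≟ᶠ_)
open import Data.Fin.Properties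
  using (splitAt-↑ˡ; splitAt-↑ʳ; remQuot-combine; combine-remQuot; splitAt⁻¹-↑ˡ; splitAt⁻¹-↑ʳ; ¬∀⟶∃¬)
open import Data.Fin.Subset using (Subset; _∈_; _∉_; ∣_∣; ⊥)
open import Data.Fin.Subset.Properties using (_∈?_; ∣⊥∣≡0)
open import Data.Vec using (Vec; []; _∷_; _++_; concat; replicate; lookup; tabulate; group)
  renaming (splitAt to splitVec)
open import Data.Vec.Properties
  using (lookup-++ʳ; lookup-concat; lookup-replicate; lookup∘tabulate; tabulate∘lookup;
         tabulate-cong; []=⇒lookup; lookup⇒[]=)
open import Data.Bool using (Bool; true; false)
open import Data.Bool.Properties using (¬-not) renaming (_≟_ to _≟ᵇ_)
open import Data.Sum using (_⊎_; inj₁; inj₂)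
open import Data.Sum.Properties using (inj₂-injective)
open import Data.Product using (_×_; _,_; proj₂; ∃-syntax)
open import Data.Product.Properties using (,-injectiveʳ)
open import Data.Unit using (⊤)
open import Data.Empty using (⊥-elim)
open import Relation.Nullary using (¬_; yes; no)
open import Relation.Nullary.Decidable using (_→-dec_)
open import Relation.Binary.PropositionalEquality
  using (_≡_; _≢_; refl; sym; trans; cong; subst; module ≡-Reasoning)

OneOf : Bool → Bool → Set
OneOf p q = (p ≡ true × ¬ q ≡ true) ⊎ (¬ p ≡ true × q ≡ true)

one-of-left : ∀ {p q} → p ≡ true → q ≡ false → OneOf p q
one-of-left p refl = inj₁ (p , λ ())

one-of-right : ∀ {p q} → p ≡ false → q ≡ true → OneOf p q
one-of-right refl q = inj₂ ((λ ()) , q)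

one-of-sym : ∀ {p q} → OneOf p q → OneOf q p
one-of-sym (inj₁ (p , q)) = inj₂ (q , p)
one-of-sym (inj₂ (p , q)) = inj₁ (q , p)

one-of-irrefl : ∀ {p} → ¬ OneOf p p
one-of-irrefl (inj₁ (p , ¬p)) = ¬p p
one-of-irrefl (inj₂ (¬p , p)) = ¬p p

one-of-subst : ∀ {p p′ q q′} → p ≡ p′ → q ≡ q′ → OneOf p q → OneOf p′ q′
one-of-subst refl refl d = d

mem-transfer : ∀ {k l} {p : Subset k} {q : Subset l} {x y} →
               lookup p x ≡ lookup q y → x ∈ p → y ∈ q
mem-transfer {q = q} {x = x} {y} e x∈p =
  lookup⇒[]= y q (trans (sym e) ([]=⇒lookup x∈p))

card-++ : ∀ {k l} (p : Subset k) (q : Subset l) → ∣ p ++ q ∣ ≡ ∣ p ∣ + ∣ q ∣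
card-++ [] q = refl
card-++ (true ∷ p) q = cong suc (card-++ p q)
card-++ (false ∷ p) q = card-++ p q

card-concat-replicate : ∀ n {m} (S : Subset m) → ∣ concat (replicate n S) ∣ ≡ n * ∣ S ∣
card-concat-replicate 0 S = refl
card-concat-replicate (suc n) S =
  trans (card-++ S (concat (replicate n S))) (cong (∣ S ∣ +_) (card-concat-replicate n S))

card-concat-≥ : ∀ {n m d} (pss : Vec (Subset m) n) →
                (∀ i → d ≤ ∣ lookup pss i ∣) → n * d ≤ ∣ concat pss ∣
card-concat-≥ [] big = z≤n
card-concat-≥ (ps ∷ pss) big =
  subst (_ ≤_) (sym (card-++ ps (concat pss)))
        (+-mono-≤ (big zero) (card-concat-≥ pss (λ i → big (suc i))))

module Coordinates (n m : ℕ) where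

  enc : CVertex n m → Fin (n + n * m)
  enc (inj₁ i) = i ↑ˡ (n * m)
  enc (inj₂ (i , a)) = n ↑ʳ combine i a

  decode-enc : ∀ c → decode n m (enc c) ≡ c
  decode-enc (inj₁ i) rewrite splitAt-↑ˡ n i (n * m) = refl
  decode-enc (inj₂ (i , a))
    rewrite splitAt-↑ʳ n (n * m) (combine i a) | remQuot-combine {n} {m} i a = refl

  enc-decode : ∀ x → enc (decode n m x) ≡ x
  enc-decode x with splitAt n x in eq
  ... | inj₁ i = splitAt⁻¹-↑ˡ eq
  ... | inj₂ p = trans (cong (n ↑ʳ_) (combine-remQuot {n} m p)) (splitAt⁻¹-↑ʳ eq)

  decode-injective : ∀ {x y} → decode n m x ≡ decode n m y → x ≡ y
  decode-injective {x} {y} e = begin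
    x                   ≡⟨ sym (enc-decode x) ⟩
    enc (decode n m x)  ≡⟨ cong enc e ⟩
    enc (decode n m y)  ≡⟨ enc-decode y ⟩
    y                   ∎
    where open ≡-Reasoning

  copy-enc-injective : ∀ {i a b} → enc (inj₂ (i , a)) ≡ enc (inj₂ (i , b)) → a ≡ b
  copy-enc-injective {i} {a} {b} e = ,-injectiveʳ (inj₂-injective (begin
    inj₂ (i , a)                     ≡⟨ sym (decode-enc (inj₂ (i , a))) ⟩
    decode n m (enc (inj₂ (i , a)))  ≡⟨ cong (decode n m) e ⟩
    decode n m (enc (inj₂ (i , b)))  ≡⟨ decode-enc (inj₂ (i , b)) ⟩
    inj₂ (i , b)                     ∎))
    where open ≡-Reasoning

  block : Subset (n + n * m) → Fin n → Subset m
  block W i = tabulate (λ a → lookup W (enc (inj₂ (i , a))))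

  lookup-block : ∀ W i a → lookup (block W i) a ≡ lookup W (enc (inj₂ (i , a)))
  lookup-block W i = lookup∘tabulate _

  blocks-bound : ∀ {d} (W : Subset (n + n * m)) →
                 (∀ i → d ≤ ∣ block W i ∣) → n * d ≤ ∣ W ∣
  blocks-bound W big with splitVec n W
  ... | hubs , leaves , refl with group n m leaves
  ... | xss , refl =
    subst (_ ≤_) (sym (card-++ hubs (concat xss)))
      (≤-trans (card-concat-≥ xss (λ i → subst (_ ≤_) (cong ∣_∣ (block-is-group i)) (big i)))
               (m≤n+m _ ∣ hubs ∣))
    where
    block-is-group : ∀ i → block (hubs ++ concat xss) i ≡ lookup xss i
    block-is-group i = trans
      (tabulate-cong (λ a → trans (lookup-++ʳ hubs (concat xss) (combine i a)) (lookup-concat xss i a)))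
      (tabulate∘lookup (lookup xss i))

module Corona {n m : ℕ} (G : Graph n) (H : Graph m) where

  open Coordinates n m

  eqF-no : ∀ {i j : Fin n} → i ≢ j → eqF i j ≡ false
  eqF-no {i} {j} i≢j with i ≟ᶠ j
  ... | yes i≡j = ⊥-elim (i≢j i≡j)
  ... | no _ = refl

  copy-hub : ∀ i a → cadj G H (inj₂ (i , a)) (inj₁ i) ≡ true
  copy-hub i a = eqF-refl i

  copy-other-hub : ∀ {i j} a → i ≢ j → cadj G H (inj₂ (i , a)) (inj₁ j) ≡ false
  copy-other-hub a i≢j = eqF-no i≢j

  within-copy : ∀ i a b → cadj G H (inj₂ (i , a)) (inj₂ (i , b)) ≡ adj H a b
  within-copy i a b rewrite eqF-refl i = refl

  across-copies : ∀ {i j} a b → i ≢ j → cadj G H (inj₂ (i , a)) (inj₂ (j , b)) ≡ false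
  across-copies a b i≢j rewrite eqF-no i≢j = refl

  separator-in-copy : ∀ c i a b → OneOf (cadj G H c (inj₂ (i , a))) (cadj G H c (inj₂ (i , b))) →
                      ∃[ s ] (c ≡ inj₂ (i , s) × OneOf (adj H s a) (adj H s b))
  separator-in-copy (inj₁ j) i a b d = ⊥-elim (one-of-irrefl d)
  separator-in-copy (inj₂ (j , s)) i a b d with i ≟ᶠ j
  ... | yes refl = s , refl , one-of-subst (within-copy i s a) (within-copy i s b) d
  ... | no i≢j = ⊥-elim (one-of-irrefl
                   (one-of-subst (across-copies s a j≢i) (across-copies s b j≢i) d))
    where
    j≢i : j ≢ i
    j≢i e = i≢j (sym e)

  block-generator : ∀ {W} → IsAdjacencyGenerator (G ⊙ H) W → ∀ i →
                    IsAdjacencyGenerator H (block W i)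
  block-generator {W} gen i a b a≢b a∉ b∉ =
    let x , x∈W , d = gen (enc (inj₂ (i , a))) (enc (inj₂ (i , b)))
                          (λ e → a≢b (copy-enc-injective e))
                          (λ a∈W → a∉ (mem-transfer (sym (lookup-block W i a)) a∈W))
                          (λ b∈W → b∉ (mem-transfer (sym (lookup-block W i b)) b∈W))
        s , x≡s , dH = separator-in-copy (decode n m x) i a b
                         (one-of-subst (cong (cadj G H (decode n m x)) (decode-enc (inj₂ (i , a))))
                                       (cong (cadj G H (decode n m x)) (decode-enc (inj₂ (i , b)))) d)
    in s , mem-transfer (s-in-block x s x≡s) x∈W , dH
    where
    s-in-block : ∀ x s → decode n m x ≡ inj₂ (i , s) → lookup W x ≡ lookup (block W i) s
    s-in-block x s x≡s = begin
      lookup W x                        ≡⟨ cong (lookup W) (sym (enc-decode x)) ⟩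
      lookup W (enc (decode n m x))     ≡⟨ cong (λ c → lookup W (enc c)) x≡s ⟩
      lookup W (enc (inj₂ (i , s)))     ≡⟨ sym (lookup-block W i s) ⟩
      lookup (block W i) s              ∎
      where open ≡-Reasoning

  generator-from-separation :
    (T : Subset (n + n * m)) →
    (∀ x y → x ≢ y → enc x ∉ T → enc y ∉ T →
       ∃[ c ] (enc c ∈ T × OneOf (cadj G H c x) (cadj G H c y))) →
    IsAdjacencyGenerator (G ⊙ H) T
  generator-from-separation T sep x y x≢y x∉ y∉ =
    let c , c∈T , d = sep (decode n m x) (decode n m y) (λ e → x≢y (decode-injective e))
                          (subst (_∉ T) (sym (enc-decode x)) x∉) (subst (_∉ T) (sym (enc-decode y)) y∉)
    in enc c , c∈T , one-of-subst (cong (λ z → cadj G H z _) (sym (decode-enc c)))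
                                  (cong (λ z → cadj G H z _) (sym (decode-enc c))) d

module _ {m : ℕ} (H : Graph m) (S : Subset m) where

  basis-card : ∀ {d} → IsAdjacencyBasis H S → DimA H d → ∣ S ∣ ≡ d
  basis-card (genS , minS) ((S′ , genS′ , ∣S′∣≡d) , minD) =
    ≤-antisym (subst (∣ S ∣ ≤_) ∣S′∣≡d (minS S′ genS′)) (minD S genS)

  dominated : IsDominating H S → ∀ b → b ∉ S → ∃[ u ] (u ∈ S × Adj H u b)
  dominated dom b b∉ with dom b
  ... | inj₁ b∈ = ⊥-elim (b∉ b∈)
  ... | inj₂ u = u

  dominating-nonempty : IsDominating H S → Fin m → ∃[ s ] (s ∈ S)
  dominating-nonempty dom v with dom v
  ... | inj₁ v∈ = v , v∈
  ... | inj₂ (u , u∈ , _) = u , u∈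

  non-neighbour : ∀ b → ¬ SubsetOfNbhd H S b → ∃[ s ] (s ∈ S × adj H s b ≡ false)
  non-neighbour b ¬sub with ¬∀⟶∃¬ m _ (λ s → (s ∈? S) →-dec (adj H b s ≟ᵇ true)) ¬sub
  ... | s , ¬in⇒adj with s ∈? S
  ...   | no s∉ = ⊥-elim (¬in⇒adj (λ s∈ → ⊥-elim (s∉ s∈)))
  ...   | yes s∈ = s , s∈ , trans (adj-sym H s b) (¬-not (λ a → ¬in⇒adj (λ _ → a)))

module Upper {n m : ℕ} (G : Graph n) (H : Graph m) (S : Subset m)
             (genS : IsAdjacencyGenerator H S) (dom : IsDominating H S)
             (nn : ∀ v → v ∉ S → ¬ SubsetOfNbhd H S v)
             {s₀ : Fin m} (s₀∈S : s₀ ∈ S) where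

  open Coordinates n m
  open Corona G H

  copies : Subset (n + n * m)
  copies = ⊥ ++ concat (replicate n S)

  card-copies : ∣ copies ∣ ≡ n * ∣ S ∣
  card-copies = begin
    ∣ copies ∣                              ≡⟨ card-++ (⊥ {n}) (concat (replicate n S)) ⟩
    ∣ ⊥ {n} ∣ + ∣ concat (replicate n S) ∣ ≡⟨ cong (_+ ∣ concat (replicate n S) ∣) (∣⊥∣≡0 n) ⟩
    ∣ concat (replicate n S) ∣              ≡⟨ card-concat-replicate n S ⟩
    n * ∣ S ∣                               ∎
    where open ≡-Reasoning

  lookup-copies : ∀ i a → lookup copies (enc (inj₂ (i , a))) ≡ lookup S a
  lookup-copies i a = begin
    lookup copies (n ↑ʳ combine i a)              ≡⟨ lookup-++ʳ (⊥ {n}) _ (combine i a) ⟩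
    lookup (concat (replicate n S)) (combine i a) ≡⟨ lookup-concat (replicate n S) i a ⟩
    lookup (lookup (replicate n S) i) a           ≡⟨ cong (λ p → lookup p a) (lookup-replicate i S) ⟩
    lookup S a                                    ∎
    where open ≡-Reasoning

  Outside : CVertex n m → Set
  Outside (inj₁ _) = ⊤
  Outside (inj₂ (_ , b)) = b ∉ S

  outside : ∀ x → enc x ∉ copies → Outside x
  outside (inj₁ _) _ = _
  outside (inj₂ (i , b)) x∉ b∈ = x∉ (mem-transfer (sym (lookup-copies i b)) b∈)

  CopySeparator : CVertex n m → CVertex n m → Set
  CopySeparator x y = ∃[ i ] ∃[ s ] (s ∈ S × OneOf (cadj G H (inj₂ (i , s)) x) (cadj G H (inj₂ (i , s)) y))

  -- A hub v_i and a copy vertex (j , b) with b ∉ S: use S_i ⊈ N(b) if i = j,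
  -- and a vertex of S_j dominating (j , b) otherwise.
  hub-vs-leaf : ∀ i j b → b ∉ S → CopySeparator (inj₁ i) (inj₂ (j , b))
  hub-vs-leaf i j b b∉ with i ≟ᶠ j
  ... | yes refl with non-neighbour H S b (nn b b∉)
  ...   | s , s∈ , s≁b = i , s , s∈ , one-of-left (copy-hub i s) (trans (within-copy i s b) s≁b)
  hub-vs-leaf i j b b∉ | no i≢j with dominated H S dom b b∉
  ...   | u , u∈ , u∼b = j , u , u∈ , one-of-right (copy-other-hub u (λ e → i≢j (sym e)))
                                                  (trans (within-copy j u b) u∼b)

  separate : ∀ x y → x ≢ y → Outside x → Outside y → CopySeparator x y
  separate (inj₁ i) (inj₁ j) i≢j _ _ =
    i , s₀ , s₀∈S , one-of-left (copy-hub i s₀) (copy-other-hub s₀ (λ e → i≢j (cong inj₁ e)))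
  separate (inj₁ i) (inj₂ (j , b)) _ _ b∉ = hub-vs-leaf i j b b∉
  separate (inj₂ (j , b)) (inj₁ i) _ b∉ _ with hub-vs-leaf i j b b∉
  ... | k , s , s∈ , d = k , s , s∈ , one-of-sym d
  separate (inj₂ (i , a)) (inj₂ (j , b)) x≢y a∉ b∉ with i ≟ᶠ j
  ... | yes refl with genS a b (λ e → x≢y (cong (λ c → inj₂ (i , c)) e)) a∉ b∉
  ...   | s , s∈ , d = i , s , s∈ , one-of-subst (sym (within-copy i s a)) (sym (within-copy i s b)) d
  separate (inj₂ (i , a)) (inj₂ (j , b)) _ a∉ _ | no i≢j with dominated H S dom a a∉
  ...   | u , u∈ , u∼a = i , u , u∈ , one-of-left (trans (within-copy i u a) u∼a) (across-copies u b i≢j)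

  copies-generator : IsAdjacencyGenerator (G ⊙ H) copies
  copies-generator = generator-from-separation copies λ x y x≢y x∉ y∉ →
    let i , s , s∈ , d = separate x y x≢y (outside x x∉) (outside y y∉)
    in inj₂ (i , s) , mem-transfer (sym (lookup-copies i s)) s∈ , d

-- Matching on
-- 2 ≤ m exposes a vertex of H, hence (S dominating) a vertex s₀ ∈ S.
theorem6 : ∀ {n m : ℕ} (G : Graph n) (H : Graph m) → 2 ≤ n → Connected G → 2 ≤ m →
    (S : Subset m) → IsAdjacencyBasis H S → IsDominating H S →
    (∀ (v : Fin m) → v ∉ S → ¬ SubsetOfNbhd H S v) →
    ∀ (d : ℕ) → DimA H d → DimA (G ⊙ H) (n * d)
theorem6 {n} G H _ _ (s≤s _) S basis@(genS , _) dom nn d dimH@(_ , minD) =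
  (copies , copies-generator , trans card-copies (cong (n *_) (basis-card H S basis dimH))) ,
  (λ W genW → blocks-bound W (λ i → minD (block W i) (Corona.block-generator G H genW i)))
  where
  open Coordinates n _
  open Upper G H S genS dom nn (proj₂ (dominating-nonempty H S dom zero))
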